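{- The AGM axiom $(K\ast5b)$, namely "if $\neg\phi$ is not a tautology then $K\circ\phi\neq\Phi_0$" (for $\phi$ in the domain of $\circ$), corresponds to the following property of Kripke-Lewis frames $\langle S,\mathcal B,f\rangle$: $$(P\ast5)\qquad \forall s\in S,\ \forall E\in 2^S\setminus\{\varnothing\},\ \exists s'\in\mathcal B(s) \text{ such that } f(s',E)\neq\varnothing.$$ That is: (1) for every model based on a frame satisfying $(P\ast5)$ and every state $s$, the partial belief change function $\circ$ based on $K_s$ defined by (RI) satisfies $K_s\circ\phi\neq\Phi_0$ for every $\phi$ with $\Vert\phi\Vert\neq\varnothing$; and (2) for every frame violating $(P\ast5)$ there is a model based on it, a state $s$ and a formula $\phi$ with $\Vert\phi\Vert\neq\varnothing$ (so $\neg\phi$ is not a tautology) such that $K_s\circ\phi=\Phi_0$.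
   Context: $\mathtt{At}$ is a countable set of atoms and $\Phi_0$ the Boolean formulas over $\mathtt{At}$ (built with $\neg,\vee$). A Kripke-Lewis frame is a triple $\langle S,\mathcal B,f\rangle$ with $S$ a set of states, $\mathcal B\subseteq S\times S$ serial, $\mathcal B(s)=\{s':s\mathcal Bs'\}$, and $f:S\times(2^S\setminus\{\varnothing\})\to2^S$ an arbitrary function. A model adds a valuation $V:\mathtt{At}\to2^S$; truth of Boolean formulas is classical and $\Vert\phi\Vert$ is the truth set. Given a model and state $s$, $K_s=\{\phi\in\Phi_0:\mathcal B(s)\subseteq\Vert\phi\Vert\}$, the domain is $\Psi=\{\phi\in\Phi_0:\Vert\phi\Vert\neq\varnothing\}$, and the partial belief change function $\circ:\Psi\to2^{\Phi_0}$ is defined by (RI): $\psi\in K_s\circ\phi$ iff $f(s',\Vert\phi\Vert)\subseteq\Vert\psi\Vert$ for all $s'\in\mathcal B(s)$. -}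

module Defs where

open import Data.Nat using (ℕ)
open import Data.Product using (Σ; ∃; _×_; _,_; ∃-syntax)
open import Data.Sum using (_⊎_)
open import Data.Empty using (⊥)
open import Relation.Nullary using (¬_)

Subset : Set → Set₁
Subset S = S → Set

NonEmpty : {S : Set} → Subset S → Set
NonEmpty {S} E = ∃[ x ] E x

_⊆_ : {S : Set} → Subset S → Subset S → Set
_⊆_ {S} A B = (x : S) → A x → B x

Atom : Set
Atom = ℕ

data Formula : Set where
  atom : Atom → Formula
  neg  : Formula → Formula
  _∨_  : Formula → Formula → Formula

-- Kripke-Lewis frame ⟨S, B, f⟩ with B serial.  f is given as a total function
-- on all subsets; only its values on non-empty subsets are ever used.
record Frame : Set₁ where
  field
    S      : Set
    B      : S → S → Set
    serial : (s : S) → ∃[ s' ] B s s'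
    f      : S → Subset S → Subset S

Valuation : Frame → Set₁
Valuation F = Atom → Subset (Frame.S F)

‖_‖ : {F : Frame} {V : Valuation F} → Formula → Subset (Frame.S F)
‖_‖ {F} {V} (atom p) s = V p s
‖_‖ {F} {V} (neg φ) s = ¬ (‖_‖ {F} {V} φ s)
‖_‖ {F} {V} (φ ∨ ψ) s = ‖_‖ {F} {V} φ s ⊎ ‖_‖ {F} {V} ψ s

truth : (F : Frame) (V : Valuation F) → Formula → Subset (Frame.S F)
truth F V φ = ‖_‖ {F} {V} φ

-- (RI): ψ ∈ K_s ∘ φ  iff  f(s', ‖φ‖) ⊆ ‖ψ‖ for all s' ∈ B(s).
revises : (F : Frame) (V : Valuation F) (s : Frame.S F) (φ ψ : Formula) → Set
revises F V s φ ψ =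
  (s' : Frame.S F) → Frame.B F s s' → Frame.f F s' (truth F V φ) ⊆ truth F V ψ

RevisionIsAll : (F : Frame) (V : Valuation F) (s : Frame.S F) (φ : Formula) → Set
RevisionIsAll F V s φ = (ψ : Formula) → revises F V s φ ψ

P*5 : Frame → Set₁
P*5 F = (s : Frame.S F) (E : Subset (Frame.S F)) → NonEmpty E →
        ∃[ s' ] (Frame.B F s s' × NonEmpty (Frame.f F s' E))

-- Violation of (P*5), stated positively (classically equivalent to ¬ P*5):
-- ∃ s, ∃ E ≠ ∅, ∀ s' ∈ B(s), f(s', E) = ∅.
ViolatesP*5 : Frame → Set₁
ViolatesP*5 F = Σ (Frame.S F) λ s → Σ (Subset (Frame.S F)) λ E →
  NonEmpty E × ((s' : Frame.S F) → Frame.B F s s' → ¬ NonEmpty (Frame.f F s' E))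

{-# OPTIONS --safe #-}
-- K_s ∘ φ = Φ₀ forces it to contain both an atom and its negation, which is
-- possible only if f(s', ‖φ‖) is empty for every s' ∈ B(s); conversely such an
-- emptiness makes (RI) hold vacuously for every ψ.  A violation of (P*5) at a
-- non-empty E is turned into a model by letting every atom be true exactly on E.
module Submission where

open import Defs
open import Data.Product using (Σ; _×_; _,_; ∃-syntax)
open import Relation.Nullary using (¬_)
open import Data.Empty using (⊥-elim)

module _ (F : Frame) (V : Valuation F) where
  open Frame F

  revision-consistent : ∀ s φ → ∃[ s' ] (B s s' × NonEmpty (f s' (truth F V φ))) →
                        ¬ RevisionIsAll F V s φ
  revision-consistent _ _ (s' , sBs' , x , x∈f) all =
    all (neg (atom 0)) s' sBs' x x∈f (all (atom 0) s' sBs' x x∈f)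

  revision-trivial : ∀ s φ → (∀ s' → B s s' → ¬ NonEmpty (f s' (truth F V φ))) →
                     RevisionIsAll F V s φ
  revision-trivial _ _ empty ψ s' sBs' x x∈f = ⊥-elim (empty s' sBs' (x , x∈f))

constantValuation : (F : Frame) → Subset (Frame.S F) → Valuation F
constantValuation F E _ = E

mainTheorem8 : (F : Frame) →
    (P*5 F → (V : Valuation F) (s : Frame.S F) (φ : Formula) →
    NonEmpty (truth F V φ) → ¬ RevisionIsAll F V s φ)
    ×
    (ViolatesP*5 F → Σ (Valuation F) λ V → Σ (Frame.S F) λ s → Σ Formula λ φ →
    NonEmpty (truth F V φ) × RevisionIsAll F V s φ)
mainTheorem8 F = soundness , completeness
  where
  soundness : P*5 F → (V : Valuation F) (s : Frame.S F) (φ : Formula) →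
              NonEmpty (truth F V φ) → ¬ RevisionIsAll F V s φ
  soundness p*5 V s φ ‖φ‖≠∅ = revision-consistent F V s φ (p*5 s (truth F V φ) ‖φ‖≠∅)

  completeness : ViolatesP*5 F → Σ (Valuation F) λ V → Σ (Frame.S F) λ s → Σ Formula λ φ →
                 NonEmpty (truth F V φ) × RevisionIsAll F V s φ
  completeness (s , E , E≠∅ , empty) =
    V , s , atom 0 , E≠∅ , revision-trivial F V s (atom 0) empty
    where V = constantValuation F E
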